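{- Let $T$ be a tree and let $T\overline{T}$ be its complementary prism. Then $\operatorname{con}(T\overline{T})\geq 2\Delta(T)+1$.
   Context: For a graph $G$ with complement $\overline{G}$, the complementary prism $G\overline{G}$ is the graph obtained from the disjoint union of $G$ and $\overline{G}$ by adding the perfect matching joining each vertex $v$ of $G$ to its copy $\overline{v}$ in $\overline{G}$. For a graph $H$, a set $S\subseteq V(H)$ is (geodesically) convex if every vertex on every shortest path between two vertices of $S$ belongs to $S$. The convexity number $\operatorname{con}(H)$ is the maximum cardinality of a proper (i.e. $\neq V(H)$) convex set of $H$. $\Delta(T)$ is the maximum degree of $T$. -}

module Defs where

import Data.Empty
import Data.Bool.Properties
import Relation.Nullary

open import Data.Nat using (ℕ; zero; suc; _≤_; _⊔_; _+_)
open import Data.Bool using (Bool; true; false; not; _∧_; if_then_else_; T)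
open import Data.Fin using (Fin; splitAt; _≟_)
open import Data.Fin.Subset using (Subset; _∈_; _∉_; ∣_∣)
open import Data.Sum using (_⊎_; inj₁; inj₂)
open import Data.List using (List; []; _∷_; map; foldr; allFin)
open import Data.Nat.ListAction using (sum)
open import Data.List.Relation.Unary.All using (All)
open import Data.List.Relation.Unary.Unique.Propositional using (Unique)
open import Data.Product using (Σ; ∃; _×_; _,_)
open import Relation.Binary.PropositionalEquality using (_≡_; refl; cong; cong₂)
open import Relation.Nullary using (¬_)
open import Relation.Nullary.Decidable using (⌊_⌋)

record Graph (n : ℕ) : Set where
  field
    adj   : Fin n → Fin n → Bool
    sym   : ∀ i j → adj i j ≡ adj j i
    irref : ∀ i → adj i i ≡ false
open Graph public

Adj : ∀ {n} → Graph n → Fin n → Fin n → Set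
Adj G i j = T (adj G i j)

data Walk {n} (G : Graph n) : Fin n → Fin n → ℕ → Set where
  []  : ∀ {u} → Walk G u u 0
  _∷_ : ∀ {u v w k} → Adj G u v → Walk G v w k → Walk G u w (suc k)

verts : ∀ {n} {G : Graph n} {u v k} → Walk G u v k → List (Fin n)
verts ([] {u}) = u ∷ []
verts (_∷_ {u} _ w) = u ∷ verts w

Connected : ∀ {n} → Graph n → Set
Connected {n} G = ∀ (u v : Fin n) → ∃ λ k → Walk G u v k

-- A cycle: a closed walk of length ≥ 3 whose vertices v₀,…,v_{k-1} are distinct.
HasCycle : ∀ {n} → Graph n → Set
HasCycle {n} G = Σ (Fin n) λ v → Σ ℕ λ k → Σ (Walk G v v k) λ w →
  (3 ≤ k) × Unique (tailV (verts w))
  where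
  tailV : List (Fin n) → List (Fin n)
  tailV [] = []
  tailV (_ ∷ xs) = xs

IsTree : ∀ {n} → Graph n → Set
IsTree {n} G = (1 ≤ n) × Connected G × ¬ HasCycle G

degree : ∀ {n} → Graph n → Fin n → ℕ
degree {n} G v = sum (map (λ j → if adj G v j then 1 else 0) (allFin n))

maxDegree : ∀ {n} → Graph n → ℕ
maxDegree {n} G = foldr _⊔_ 0 (map (degree G) (allFin n))

-- Complementary prism G Ḡ on Fin (n + n): the first copy is G, the second
-- copy is the complement Ḡ, and vertex i of G is joined to its copy ī.
prismAdj : ∀ {n} → Graph n → Fin (n + n) → Fin (n + n) → Bool
prismAdj {n} G x y with splitAt n x | splitAt n y
... | inj₁ a | inj₁ b = adj G a b
... | inj₂ a | inj₂ b = not (adj G a b) ∧ not ⌊ a ≟ b ⌋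
... | inj₁ a | inj₂ b = ⌊ a ≟ b ⌋
... | inj₂ a | inj₁ b = ⌊ a ≟ b ⌋

IsShortest : ∀ {n} {G : Graph n} {u v k} → Walk G u v k → Set
IsShortest {n} {G} {u} {v} {k} _ = ∀ m → Walk G u v m → k ≤ m

IsConvex : ∀ {n} → Graph n → Subset n → Set
IsConvex {n} G S = ∀ (u v : Fin n) k (w : Walk G u v k) →
  u ∈ S → v ∈ S → IsShortest w → All (_∈ S) (verts w)

IsProper : ∀ {n} → Subset n → Set
IsProper {n} S = ∃ λ (x : Fin n) → x ∉ S

IsConvexityNumber : ∀ {n} → Graph n → ℕ → Set
IsConvexityNumber {n} G c =
  (Σ (Subset n) λ S → IsConvex G S × IsProper S × ∣ S ∣ ≡ c) ×
  (∀ (S : Subset n) → IsConvex G S → IsProper S → ∣ S ∣ ≤ c)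

private
  eqb-sym : ∀ {n} (a b : Fin n) → ⌊ a ≟ b ⌋ ≡ ⌊ b ≟ a ⌋
  eqb-sym a b with a ≟ b | b ≟ a
  ... | Relation.Nullary.yes _ | Relation.Nullary.yes _ = refl
  ... | Relation.Nullary.no _  | Relation.Nullary.no _  = refl
  ... | Relation.Nullary.yes refl | Relation.Nullary.no ne = Data.Empty.⊥-elim (ne refl)
  ... | Relation.Nullary.no ne | Relation.Nullary.yes refl = Data.Empty.⊥-elim (ne refl)

  prism-sym : ∀ {n} (G : Graph n) x y → prismAdj G x y ≡ prismAdj G y x
  prism-sym {n} G x y with splitAt n x | splitAt n y
  ... | inj₁ a | inj₁ b = sym G a b
  ... | inj₂ a | inj₂ b = cong₂ (λ p q → not p ∧ not q) (sym G a b) (eqb-sym a b)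
  ... | inj₁ a | inj₂ b = eqb-sym a b
  ... | inj₂ a | inj₁ b = eqb-sym a b

  prism-irr : ∀ {n} (G : Graph n) x → prismAdj G x x ≡ false
  prism-irr {n} G x with splitAt n x
  ... | inj₁ a = irref G a
  ... | inj₂ a with a ≟ a
  ...   | Relation.Nullary.yes _ = Data.Bool.Properties.∧-zeroʳ (not (adj G a a))
  ...   | Relation.Nullary.no ne = Data.Empty.⊥-elim (ne refl)

complementaryPrism : ∀ {n} → Graph n → Graph (n + n)
complementaryPrism G = record
  { adj = prismAdj G ; sym = prism-sym G ; irref = prism-irr G }

-- Let v be a vertex of maximum degree d = Δ(T) and put
--   S = N_T[v] ∪ { ū : u ∈ N_T(v) }   (closed neighbourhood of v in T,
--                                        plus the copies of its neighbours).
-- Then |S| = (d + 1) + d and S is proper since v̄ ∉ S, so it suffices to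
-- show that S is convex in T T̄.  We use a general criterion: a set S in
-- which any two vertices are at distance ≤ 2 and which contains every common
-- neighbour of two distinct non-adjacent vertices of S is convex.  Both
-- conditions hold for S as soon as v lies on no 3-cycle and no 4-cycle of T,
-- which is all that acyclicity is used for.
module Submission where

open import Defs
open import Data.Nat using (ℕ; zero; suc; z≤n; s≤s; _≤_; _+_; _*_; _⊔_)
import Data.Nat.Properties as ℕₚ
open import Data.Bool using (Bool; true; false; not; T; if_then_else_)
open import Data.Unit using (tt)
open import Data.Bool.Properties using (T-≡; T-∧)
open import Data.Empty using (⊥-elim)
open import Data.Fin using (Fin; splitAt; join; _↑ˡ_; _↑ʳ_; _≟_)
open import Data.Fin.Properties using (splitAt-join; join-splitAt)
open import Data.Fin.Subset using (Subset; _∈_; ∣_∣; _∪_; ⁅_⁆; inside; outside)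
open import Data.Fin.Subset.Properties using (x∈⁅x⁆; x∈⁅y⁆⇒x≡y; x∈p∪q⁺; x∈p∪q⁻; q⊆p∪q; p⊂q⇒∣p∣<∣q∣)
open import Data.Vec using (Vec; tabulate; _++_)
open import Data.Vec.Properties using (lookup-++ˡ; lookup-++ʳ; []=⇒lookup; lookup⇒[]=; lookup∘tabulate)
open import Data.List as List using (List; map; foldr; allFin)
open import Data.List.Properties using (map-tabulate)
open import Data.Nat.ListAction using (sum)
open import Data.List.Relation.Unary.All using ([]; _∷_)
open import Data.List.Relation.Unary.AllPairs using ([]; _∷_)
open import Data.Product using (Σ; _×_; _,_)
open import Data.Sum using (_⊎_; inj₁; inj₂)
open import Function using (_∘_)
open import Function.Bundles using (Equivalence)
open import Relation.Binary.PropositionalEquality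
  using (_≡_; _≢_; refl; cong; trans; subst; subst₂; ≢-sym)
import Relation.Binary.PropositionalEquality as ≡
open import Relation.Nullary using (¬_; yes; no; contradiction)
open import Relation.Nullary.Decidable
  using (toWitness; fromWitness; toWitnessFalse; fromWitnessFalse)

T-not⇒¬T : ∀ b → T (not b) → ¬ T b
T-not⇒¬T true ()
T-not⇒¬T false _ ()

¬T⇒T-not : ∀ b → ¬ T b → T (not b)
¬T⇒T-not true ¬t = ¬t tt
¬T⇒T-not false _ = tt

module _ {m} {G : Graph m} where

  adj-sym : ∀ {a b} → Adj G a b → Adj G b a
  adj-sym {a} {b} = subst T (Graph.sym G a b)

  adj⇒≢ : ∀ {a b} → Adj G a b → a ≢ b
  adj⇒≢ {a} e refl = subst T (irref G a) e

  Close : Fin m → Fin m → Set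
  Close x y = x ≡ y ⊎ Adj G x y

  WithinTwo : Fin m → Fin m → Set
  WithinTwo x y = Σ (Fin m) λ z → Close x z × Close z y

  withinTwo⇒walk : ∀ {x y} → WithinTwo x y → Σ ℕ λ k → k ≤ 2 × Walk G x y k
  withinTwo⇒walk (_ , inj₁ refl , inj₁ refl) = 0 , z≤n , []
  withinTwo⇒walk (_ , inj₁ refl , inj₂ e)    = 1 , s≤s z≤n , e ∷ []
  withinTwo⇒walk (_ , inj₂ e    , inj₁ refl) = 1 , s≤s z≤n , e ∷ []
  withinTwo⇒walk (_ , inj₂ e    , inj₂ f)    = 2 , ℕₚ.≤-refl , e ∷ (f ∷ [])

  -- Geodesics of length ≥ 3 between members of S cannot
  -- exist, and the middle vertex of a geodesic of length 2 is such a common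
  -- neighbour.
  diameter≤2⇒convex : (S : Subset m) →
    (∀ {x y} → x ∈ S → y ∈ S → WithinTwo x y) →
    (∀ {x y z} → x ∈ S → y ∈ S → x ≢ y → ¬ Adj G x y →
       Adj G x z → Adj G z y → z ∈ S) →
    IsConvex G S
  diameter≤2⇒convex S near closed u v .0 [] uS vS shortest = uS ∷ []
  diameter≤2⇒convex S near closed u v .1 (e ∷ []) uS vS shortest = uS ∷ vS ∷ []
  diameter≤2⇒convex S near closed u v .2 (e ∷ (f ∷ [])) uS vS shortest =
    uS ∷ closed uS vS u≢v ¬uv e f ∷ vS ∷ []
    where
    u≢v : u ≢ v
    u≢v refl = contradiction (shortest 0 []) λ ()
    ¬uv : ¬ Adj G u v
    ¬uv g = contradiction (shortest 1 (g ∷ [])) λ { (s≤s ()) }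
  diameter≤2⇒convex S near closed u v _ (e ∷ (f ∷ (g ∷ w))) uS vS shortest
    with withinTwo⇒walk (near uS vS)
  ... | k , k≤2 , w′ =
    contradiction (ℕₚ.≤-trans (shortest k w′) k≤2) λ { (s≤s (s≤s ())) }

  acyclic⇒noTriangle : ¬ HasCycle G →
    ∀ {v a b} → Adj G v a → Adj G v b → ¬ Adj G a b
  acyclic⇒noTriangle acyclic {v} va vb ab =
    acyclic (v , 3 , (va ∷ (ab ∷ (adj-sym vb ∷ []))) , s≤s (s≤s (s≤s z≤n)) ,
      ((adj⇒≢ ab ∷ ≢-sym (adj⇒≢ va) ∷ []) ∷ (≢-sym (adj⇒≢ vb) ∷ []) ∷ [] ∷ []))

  acyclic⇒noSquare : ¬ HasCycle G →
    ∀ {v a b z} → Adj G v a → Adj G v b → a ≢ b →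
    Adj G a z → Adj G z b → z ≡ v
  acyclic⇒noSquare acyclic {v} {z = z} va vb a≢b az zb with z ≟ v
  ... | yes z≡v = z≡v
  ... | no z≢v = ⊥-elim (acyclic (v , 4 ,
        (va ∷ (az ∷ (zb ∷ (adj-sym vb ∷ [])))) , s≤s (s≤s (s≤s z≤n)) ,
        ((adj⇒≢ az ∷ a≢b ∷ ≢-sym (adj⇒≢ va) ∷ []) ∷
         (adj⇒≢ zb ∷ z≢v ∷ []) ∷
         (≢-sym (adj⇒≢ vb) ∷ []) ∷ [] ∷ [])))

module _ {k l} (p : Subset k) (q : Subset l) where

  ∈-++ˡ⁺ : ∀ {i} → i ∈ p → i ↑ˡ l ∈ p ++ q
  ∈-++ˡ⁺ {i} i∈p = lookup⇒[]= _ (p ++ q) (trans (lookup-++ˡ p q i) ([]=⇒lookup i∈p))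

  ∈-++ˡ⁻ : ∀ i → i ↑ˡ l ∈ p ++ q → i ∈ p
  ∈-++ˡ⁻ i m = lookup⇒[]= i p (trans (≡.sym (lookup-++ˡ p q i)) ([]=⇒lookup m))

  ∈-++ʳ⁺ : ∀ {i} → i ∈ q → k ↑ʳ i ∈ p ++ q
  ∈-++ʳ⁺ {i} i∈q = lookup⇒[]= _ (p ++ q) (trans (lookup-++ʳ p q i) ([]=⇒lookup i∈q))

  ∈-++ʳ⁻ : ∀ i → k ↑ʳ i ∈ p ++ q → i ∈ q
  ∈-++ʳ⁻ i m = lookup⇒[]= i q (trans (≡.sym (lookup-++ʳ p q i)) ([]=⇒lookup m))

∣++∣ : ∀ {k l} (p : Subset k) (q : Subset l) → ∣ p ++ q ∣ ≡ ∣ p ∣ + ∣ q ∣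
∣++∣ Vec.[] q = refl
∣++∣ (inside Vec.∷ p) q = cong suc (∣++∣ p q)
∣++∣ (outside Vec.∷ p) q = ∣++∣ p q

module _ {k} (f : Fin k → Bool) where

  ∈-tabulate⁺ : ∀ {i} → T (f i) → i ∈ tabulate f
  ∈-tabulate⁺ {i} t =
    lookup⇒[]= i _ (trans (lookup∘tabulate f i) (Equivalence.to T-≡ t))

  ∈-tabulate⁻ : ∀ {i} → i ∈ tabulate f → T (f i)
  ∈-tabulate⁻ {i} m =
    Equivalence.from T-≡ (trans (≡.sym (lookup∘tabulate f i)) ([]=⇒lookup m))

  ∣tabulate∣ : ∣ tabulate f ∣ ≡ sum (map (λ i → if f i then 1 else 0) (allFin k))
  ∣tabulate∣ = trans (count k f)
    (cong sum (≡.sym (map-tabulate (λ i → i) (λ i → if f i then 1 else 0))))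
    where
    count : ∀ j (g : Fin j → Bool) →
      ∣ tabulate g ∣ ≡ sum (List.tabulate (λ i → if g i then 1 else 0))
    count zero g = refl
    count (suc j) g with g Fin.zero
    ... | true  = cong suc (count j (g ∘ Fin.suc))
    ... | false = count j (g ∘ Fin.suc)

-- The maximum of f over a list is attained (at the default d for []).
maximum-attained : ∀ {A : Set} (f : A → ℕ) (xs : List A) (d : A) →
  Σ A λ w → foldr _⊔_ 0 (map f xs) ≤ f w
maximum-attained f List.[] d = d , z≤n
maximum-attained f (x List.∷ xs) d with maximum-attained f xs d
... | w , max≤fw with f x ℕₚ.≤? f w
...   | yes fx≤fw = w , ℕₚ.⊔-lub fx≤fw max≤fw
...   | no fx≰fw = x , ℕₚ.⊔-lub ℕₚ.≤-refl
                         (ℕₚ.≤-trans max≤fw (ℕₚ.<⇒≤ (ℕₚ.≰⇒> fx≰fw)))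

-- The complementary prism G Ḡ seen on the vertex type Fin n ⊎ Fin n,
-- where inj₁ a is the vertex a of G and inj₂ a its copy ā in Ḡ.
module Prism {n} (G : Graph n) where

  PG : Graph (n + n)
  PG = complementaryPrism G

  Vertex : Set
  Vertex = Fin n ⊎ Fin n

  ⟨_⟩ : Vertex → Fin (n + n)
  ⟨_⟩ = join n n

  data Split : Fin (n + n) → Set where
    ⟨_⟩ᵛ : (s : Vertex) → Split ⟨ s ⟩

  split : ∀ x → Split x
  split x = subst Split (join-splitAt n n x) ⟨ splitAt n x ⟩ᵛ

  data PrismAdj : Vertex → Vertex → Set where
    edge   : ∀ {a b} → Adj G a b → PrismAdj (inj₁ a) (inj₁ b)
    coedge : ∀ {a b} → ¬ Adj G a b → a ≢ b → PrismAdj (inj₂ a) (inj₂ b)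
    match  : ∀ {a} → PrismAdj (inj₁ a) (inj₂ a)
    match′ : ∀ {a} → PrismAdj (inj₂ a) (inj₁ a)

  prismAdj-sym : ∀ {s t} → PrismAdj s t → PrismAdj t s
  prismAdj-sym (edge e)        = edge (adj-sym {G = G} e)
  prismAdj-sym (coedge ¬e a≢b) = coedge (¬e ∘ adj-sym {G = G}) (≢-sym a≢b)
  prismAdj-sym match           = match′
  prismAdj-sym match′          = match

  -- prismAdj is defined by cases on splitAt, so it can be read off (and
  -- produced) from PrismAdj on the split vertices.
  private
    fromSplit : ∀ x y → T (prismAdj G x y) → PrismAdj (splitAt n x) (splitAt n y)
    fromSplit x y with splitAt n x | splitAt n y
    ... | inj₁ a | inj₁ b = edge
    ... | inj₂ a | inj₂ b = λ t → let ¬e , a≢b = Equivalence.to T-∧ t in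
      coedge (T-not⇒¬T (adj G a b) ¬e) (toWitnessFalse {a? = a ≟ b} a≢b)
    ... | inj₁ a | inj₂ b = λ t → subst (λ c → PrismAdj _ (inj₂ c)) (toWitness t) match
    ... | inj₂ a | inj₁ b = λ t → subst (λ c → PrismAdj _ (inj₁ c)) (toWitness t) match′

    toSplit : ∀ x y → PrismAdj (splitAt n x) (splitAt n y) → T (prismAdj G x y)
    toSplit x y with splitAt n x | splitAt n y
    ... | inj₁ a | inj₁ b = λ { (edge e) → e }
    ... | inj₂ a | inj₂ b = λ { (coedge ¬e a≢b) → Equivalence.from T-∧
          (¬T⇒T-not (adj G a b) ¬e , fromWitnessFalse {a? = a ≟ b} a≢b) }
    ... | inj₁ a | inj₂ b = λ { match → fromWitness refl }
    ... | inj₂ a | inj₁ b = λ { match′ → fromWitness refl }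

  adj⇒prismAdj : ∀ s t → Adj PG ⟨ s ⟩ ⟨ t ⟩ → PrismAdj s t
  adj⇒prismAdj s t e =
    subst₂ PrismAdj (splitAt-join n n s) (splitAt-join n n t) (fromSplit ⟨ s ⟩ ⟨ t ⟩ e)

  prismAdj⇒adj : ∀ {s t} → PrismAdj s t → Adj PG ⟨ s ⟩ ⟨ t ⟩
  prismAdj⇒adj {s} {t} e = toSplit ⟨ s ⟩ ⟨ t ⟩
    (subst₂ PrismAdj (≡.sym (splitAt-join n n s)) (≡.sym (splitAt-join n n t)) e)

  CloseV : Vertex → Vertex → Set
  CloseV s t = s ≡ t ⊎ PrismAdj s t

  closeV-sym : ∀ {s t} → CloseV s t → CloseV t s
  closeV-sym (inj₁ refl) = inj₁ refl
  closeV-sym (inj₂ e)    = inj₂ (prismAdj-sym e)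

  closeV⇒close : ∀ {s t} → CloseV s t → Close {G = PG} ⟨ s ⟩ ⟨ t ⟩
  closeV⇒close (inj₁ refl) = inj₁ refl
  closeV⇒close (inj₂ e)    = inj₂ (prismAdj⇒adj e)

module StarSet {n} (G : Graph n) (v : Fin n)
  (noTriangle : ∀ {a b} → Adj G v a → Adj G v b → ¬ Adj G a b)
  (noSquare : ∀ {a b z} → Adj G v a → Adj G v b → a ≢ b →
                Adj G a z → Adj G z b → z ≡ v)
  where

  open Prism G

  N N[v] : Subset n
  N    = tabulate (adj G v)
  N[v] = ⁅ v ⁆ ∪ N

  S : Subset (n + n)
  S = N[v] ++ N

  data InS : Vertex → Set where
    centre        : InS (inj₁ v)
    neighbour     : ∀ {a} → Adj G v a → InS (inj₁ a)
    neighbourCopy : ∀ {a} → Adj G v a → InS (inj₂ a)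

  inS⇒∈ : ∀ {s} → InS s → ⟨ s ⟩ ∈ S
  inS⇒∈ centre            = ∈-++ˡ⁺ N[v] N (x∈p∪q⁺ (inj₁ (x∈⁅x⁆ v)))
  inS⇒∈ (neighbour va)    = ∈-++ˡ⁺ N[v] N (x∈p∪q⁺ (inj₂ (∈-tabulate⁺ (adj G v) va)))
  inS⇒∈ (neighbourCopy va) = ∈-++ʳ⁺ N[v] N (∈-tabulate⁺ (adj G v) va)

  ∈⇒inS : ∀ s → ⟨ s ⟩ ∈ S → InS s
  ∈⇒inS (inj₁ a) m with x∈p∪q⁻ ⁅ v ⁆ N (∈-++ˡ⁻ N[v] N a m)
  ... | inj₁ a∈⁅v⁆ = subst (InS ∘ inj₁) (≡.sym (x∈⁅y⁆⇒x≡y v a∈⁅v⁆)) centre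
  ... | inj₂ a∈N   = neighbour (∈-tabulate⁻ (adj G v) a∈N)
  ∈⇒inS (inj₂ a) m = neighbourCopy (∈-tabulate⁻ (adj G v) (∈-++ʳ⁻ N[v] N a m))

  -- Distance ≤ 2 inside S: the copies of neighbours of v are pairwise
  -- adjacent in Ḡ (no triangle at v), vertices of N[v] meet at v, and a
  -- copy b̄ is reached from v through b and from a ∈ N(v) through ā.
  copiesClose : ∀ {a b} → Adj G v a → Adj G v b → CloseV (inj₂ a) (inj₂ b)
  copiesClose {a} {b} va vb with a ≟ b
  ... | yes refl = inj₁ refl
  ... | no a≢b   = inj₂ (coedge (noTriangle va vb) a≢b)

  toCentre : ∀ {a} → InS (inj₁ a) → CloseV (inj₁ a) (inj₁ v)
  toCentre centre         = inj₁ refl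
  toCentre (neighbour va) = inj₂ (edge (adj-sym {G = G} va))

  Near : Vertex → Vertex → Set
  Near s t = Σ Vertex λ u → CloseV s u × CloseV u t

  nearMixed : ∀ {a b} → InS (inj₁ a) → InS (inj₂ b) → Near (inj₁ a) (inj₂ b)
  nearMixed centre (neighbourCopy vb)         = inj₁ _ , inj₂ (edge vb) , inj₂ match
  nearMixed (neighbour va) (neighbourCopy vb) = inj₂ _ , inj₂ match , copiesClose va vb

  near : ∀ {s t} → InS s → InS t → Near s t
  near {inj₁ _} {inj₁ _} x y = inj₁ v , toCentre x , closeV-sym (toCentre y)
  near {inj₁ _} {inj₂ _} x y = nearMixed x y
  near {inj₂ _} {inj₁ _} x y with nearMixed y x
  ... | u , yu , ux = u , closeV-sym ux , closeV-sym yu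
  near {inj₂ _} {inj₂ _} (neighbourCopy va) (neighbourCopy vb) =
    inj₂ _ , inj₁ refl , copiesClose va vb

  -- The only non-trivial case is u ∈ G adjacent to two distinct
  -- neighbours of v, where the absence of 4-cycles forces u = v.
  closed : ∀ {s t u} → InS s → InS t → s ≢ t → ¬ PrismAdj s t →
    PrismAdj s u → PrismAdj u t → InS u
  closed centre _ _ _ (edge vr) _ = neighbour vr
  closed centre (neighbourCopy vq) _ _ match (coedge ¬vq _) = ⊥-elim (¬vq vq)
  closed centre _ s≢t _ match match′ = ⊥-elim (s≢t refl)
  closed (neighbour va) _ _ _ match _ = neighbourCopy va
  closed (neighbour va) centre _ _ (edge _) (edge rv) = neighbour (adj-sym {G = G} rv)
  closed (neighbour va) (neighbour vb) s≢t _ (edge ar) (edge rb) =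
    subst (InS ∘ inj₁) (≡.sym (noSquare va vb (s≢t ∘ cong inj₁) ar rb)) centre
  closed (neighbour _) (neighbourCopy vr) _ _ (edge _) match = neighbour vr
  closed (neighbourCopy va) _ _ _ match′ _ = neighbour va
  closed (neighbourCopy va) (neighbourCopy vb) s≢t ¬st (coedge _ _) (coedge _ _) =
    ⊥-elim (¬st (coedge (noTriangle va vb) (s≢t ∘ cong inj₂)))
  closed (neighbourCopy va) centre _ _ (coedge ¬av _) match′ = ⊥-elim (¬av (adj-sym {G = G} va))
  closed (neighbourCopy _) (neighbour vr) _ _ (coedge _ _) match′ = neighbourCopy vr

  convex : IsConvex PG S
  convex = diameter≤2⇒convex S nearPG closedPG
    where
    nearPG : ∀ {x y} → x ∈ S → y ∈ S → WithinTwo {G = PG} x y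
    nearPG {x} {y} xS yS with split x | split y
    ... | ⟨ s ⟩ᵛ | ⟨ t ⟩ᵛ with near (∈⇒inS s xS) (∈⇒inS t yS)
    ...   | u , su , ut = ⟨ u ⟩ , closeV⇒close su , closeV⇒close ut

    closedPG : ∀ {x y z} → x ∈ S → y ∈ S → x ≢ y → ¬ Adj PG x y →
      Adj PG x z → Adj PG z y → z ∈ S
    closedPG {x} {y} {z} xS yS x≢y ¬xy xz zy with split x | split y | split z
    ... | ⟨ s ⟩ᵛ | ⟨ t ⟩ᵛ | ⟨ u ⟩ᵛ = inS⇒∈ (closed (∈⇒inS s xS) (∈⇒inS t yS)
      (x≢y ∘ cong ⟨_⟩) (¬xy ∘ prismAdj⇒adj) (adj⇒prismAdj s u xz) (adj⇒prismAdj u t zy))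

  proper : IsProper S
  proper = ⟨ inj₂ v ⟩ , λ v̄∈S → v̄∉S (∈⇒inS (inj₂ v) v̄∈S)
    where
    v̄∉S : ¬ InS (inj₂ v)
    v̄∉S (neighbourCopy vv) = adj⇒≢ {G = G} vv refl

  size : 2 * degree G v + 1 ≤ ∣ S ∣
  size = begin
    2 * degree G v + 1 ≡⟨ cong (λ d → 2 * d + 1) (≡.sym (∣tabulate∣ (adj G v))) ⟩
    2 * ∣ N ∣ + 1      ≡⟨ twice+1 ∣ N ∣ ⟩
    suc ∣ N ∣ + ∣ N ∣  ≤⟨ ℕₚ.+-monoˡ-≤ ∣ N ∣ N⊂N[v] ⟩
    ∣ N[v] ∣ + ∣ N ∣   ≡⟨ ≡.sym (∣++∣ N[v] N) ⟩
    ∣ S ∣              ∎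
    where
    open ℕₚ.≤-Reasoning
    twice+1 : ∀ d → 2 * d + 1 ≡ suc d + d
    twice+1 d = trans (ℕₚ.+-comm (2 * d) 1) (cong (λ k → suc (d + k)) (ℕₚ.+-identityʳ d))
    N⊂N[v] : suc ∣ N ∣ ≤ ∣ N[v] ∣
    N⊂N[v] = p⊂q⇒∣p∣<∣q∣ (q⊆p∪q ⁅ v ⁆ N , v , x∈p∪q⁺ (inj₁ (x∈⁅x⁆ v)) ,
                           λ v∈N → adj⇒≢ {G = G} (∈-tabulate⁻ (adj G v) v∈N) refl)

lemma3p6 : ∀ {n} (T : Graph n) → IsTree T → ∀ (c : ℕ) →
    IsConvexityNumber (complementaryPrism T) c → 2 * maxDegree T + 1 ≤ c
lemma3p6 {suc n} G (_ , _ , acyclic) c (_ , maximal)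
  with maximum-attained (degree G) (allFin (suc n)) Fin.zero
... | v , Δ≤deg = begin
  2 * maxDegree G + 1 ≤⟨ ℕₚ.+-monoˡ-≤ 1 (ℕₚ.*-monoʳ-≤ 2 Δ≤deg) ⟩
  2 * degree G v + 1  ≤⟨ size ⟩
  ∣ S ∣               ≤⟨ maximal S convex proper ⟩
  c                   ∎
  where
  open ℕₚ.≤-Reasoning
  open StarSet G v (acyclic⇒noTriangle acyclic) (acyclic⇒noSquare acyclic)
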